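{- Let $v\equiv 10\pmod{20}$. Consider any decomposition of the edge set of $K_v$ into copies of $K_3$, $K_4$ and $K_5$ with exactly $\frac{v^2+5v+10}{20}$ cliques in total, of which exactly $5$ are copies of $K_3$. Then these five triangles are pairwise vertex-disjoint.
   Context: A decomposition of the edge set of $K_v$ into cliques means a collection of complete subgraphs of $K_v$ such that every edge of $K_v$ lies in exactly one of them. -}

module Defs where

open import Data.Nat using (ℕ; _+_; _*_; _≡ᵇ_)
open import Data.Fin using (Fin)
open import Data.Fin.Properties using () renaming (_≟_ to _≟ᶠ_)
open import Data.List using (List; length; filter)
open import Data.List.Membership.Propositional using (_∈_)
import Data.List.Membership.DecPropositional as DecMem
open import Data.List.Relation.Unary.Unique.Propositional using (Unique)
open import Data.Product using (_×_; _,_)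
open import Data.Sum using (_⊎_)
open import Relation.Binary.PropositionalEquality using (_≡_; _≢_)
open import Relation.Nullary.Decidable using (_×-dec_)

-- A clique of K_v is given by its vertex list (without repetitions);
-- the complete graph on those vertices is the clique.
IsClique : (v : ℕ) → List (Fin v) → Set
IsClique v C = Unique C

Size345 : {v : ℕ} → List (Fin v) → Set
Size345 C = (length C ≡ 3) ⊎ ((length C ≡ 4) ⊎ (length C ≡ 5))

blocksContaining : {v : ℕ} → Fin v → Fin v → List (List (Fin v)) → List (List (Fin v))
blocksContaining {v} x y = filter (λ C → (x ∈? C) ×-dec (y ∈? C))
  where open DecMem (_≟ᶠ_ {v}) using (_∈?_)

-- A decomposition of the edges of K_v into cliques with vertex-sets in D
-- (as a list, so repeated cliques are counted separately):
-- every edge {x,y}, x ≢ y, lies in exactly one clique.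
IsCliqueDecomposition : (v : ℕ) → List (List (Fin v)) → Set
IsCliqueDecomposition v D =
  ((C : List (Fin v)) → C ∈ D → IsClique v C) ×
  ((x y : Fin v) → x ≢ y → length (blocksContaining x y D) ≡ 1)

triangles : {v : ℕ} → List (List (Fin v)) → List (List (Fin v))
triangles = filter (λ C → length C Data.Nat.≟ 3)

module Submission where

-- Let t_y, a_y, b_y count the triangles, K₄'s and K₅'s through a vertex y.
-- Each other vertex shares exactly one clique with y, so 2t_y + 3a_y + 4b_y = v − 1;
-- as v ≡ 2 (mod 4) this forces a_y + 2t_y ≥ 3.  Summing the local identity over
-- all vertices and combining it with the prescribed number of cliques gives
-- Σ_y (a_y + 2t_y) + T = 3v + 5, where T is the number of triangles.  For T = 5
-- every vertex therefore has a_y + 2t_y = 3 exactly, whereas a vertex on two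
-- triangles would have 2t_y ≥ 4.

open import Defs
open import Data.Nat using (ℕ; zero; suc; _+_; _*_; _%_; _/_; _≤_; z≤n; s≤s; _≟_)
open import Data.Nat.Properties hiding (_≟_)
open import Data.Nat.DivMod using (m≡m%n+[m/n]*n; [m+kn]%n≡m%n; m/n*n≡m)
open import Data.Nat.Divisibility using (_∣_; divides)
open import Data.Nat.Tactic.RingSolver using (solve-∀)
open import Algebra.Properties.Semiring.Sum +-*-semiring
  using (sum-syntax; sum-remove; sum-cong-≗; ∑-distrib-+; ∑-comm; *-distribˡ-sum; *-distribʳ-sum)
open import Data.Fin using (Fin; zero; suc; punchIn; punchOut)
open import Data.Fin.Properties using (punchInᵢ≢i; punchIn-punchOut) renaming (_≟_ to _≟ᶠ_)
open import Data.List using (List; []; _∷_; length; lookup; filter)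
open import Data.List.Membership.Propositional using (_∈_; _∉_)
open import Data.List.Membership.Propositional.Properties using (∈-lookup)
import Data.List.Membership.DecPropositional as DecMembership
open import Data.List.Relation.Unary.All.Properties using (All¬⇒¬Any)
open import Data.List.Relation.Unary.AllPairs using (_∷_)
open import Data.List.Relation.Unary.Unique.Propositional using (Unique)
open import Data.Product using (_×_; _,_)
open import Data.Sum using (_⊎_; inj₁; inj₂)
open import Function using (_∘_)
open import Relation.Binary.PropositionalEquality
open import Relation.Nullary using (Dec; yes; no; ¬_; contradiction)
open import Relation.Nullary.Decidable using (_×-dec_)

χ : ∀ {p} {P : Set p} → Dec P → ℕ
χ (yes _) = 1
χ (no _)  = 0

χ-yes : ∀ {p} {P : Set p} (P? : Dec P) → P → χ P? ≡ 1
χ-yes (yes _)  _ = refl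
χ-yes (no ¬p)  p = contradiction p ¬p

χ-no : ∀ {p} {P : Set p} (P? : Dec P) → ¬ P → χ P? ≡ 0
χ-no (yes p) ¬p = contradiction p ¬p
χ-no (no _)  _  = refl

χ-idem : ∀ {p} {P : Set p} (P? : Dec P) → χ P? * χ P? ≡ χ P?
χ-idem (yes _) = refl
χ-idem (no _)  = refl

χ-×-dec : ∀ {p q} {P : Set p} {Q : Set q} (P? : Dec P) (Q? : Dec Q) →
          χ (P? ×-dec Q?) ≡ χ P? * χ Q?
χ-×-dec (yes _) (yes _) = refl
χ-×-dec (yes _) (no _)  = refl
χ-×-dec (no _)  _       = refl

χ≟-*ʳ : ∀ m k → χ (m ≟ k) * m ≡ χ (m ≟ k) * k
χ≟-*ʳ m k with m ≟ k
... | yes refl = refl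
... | no _     = refl

χ≟-weight : ∀ m k a → χ (m ≟ k) * (a * m) ≡ χ (m ≟ k) * a * k
χ≟-weight m k a with m ≟ k
... | yes refl = sym (*-assoc 1 a m)
... | no _     = refl

χ-size345-sum : ∀ {m} → m ≡ 3 ⊎ m ≡ 4 ⊎ m ≡ 5 → χ (m ≟ 3) + χ (m ≟ 4) + χ (m ≟ 5) ≡ 1
χ-size345-sum (inj₁ refl)        = refl
χ-size345-sum (inj₂ (inj₁ refl)) = refl
χ-size345-sum (inj₂ (inj₂ refl)) = refl

χ-size345-split : ∀ {m} → m ≡ 3 ⊎ m ≡ 4 ⊎ m ≡ 5 → ∀ a →
                  a ≡ χ (m ≟ 3) * a + χ (m ≟ 4) * a + χ (m ≟ 5) * a
χ-size345-split {m} m∈345 a = begin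
  a                                               ≡⟨ *-identityˡ a ⟨
  1 * a                                           ≡⟨ cong (_* a) (χ-size345-sum m∈345) ⟨
  (χ₃ + χ₄ + χ₅) * a                              ≡⟨ *-distribʳ-+ a (χ₃ + χ₄) χ₅ ⟩
  (χ₃ + χ₄) * a + χ₅ * a                          ≡⟨ cong (_+ χ₅ * a) (*-distribʳ-+ a χ₃ χ₄) ⟩
  χ₃ * a + χ₄ * a + χ₅ * a                        ∎
  where
  open ≡-Reasoning
  χ₃ χ₄ χ₅ : ℕ
  χ₃ = χ (m ≟ 3)
  χ₄ = χ (m ≟ 4)
  χ₅ = χ (m ≟ 5)

∑-const : ∀ n c → ∑[ i < n ] c ≡ n * c
∑-const zero    c = refl
∑-const (suc n) c = cong (c +_) (∑-const n c)

∑-mono-≤ : ∀ {n} {f g : Fin n → ℕ} → (∀ i → f i ≤ g i) → ∑[ i < n ] f i ≤ ∑[ i < n ] g i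
∑-mono-≤ {zero}  f≤g = z≤n
∑-mono-≤ {suc n} f≤g = +-mono-≤ (f≤g zero) (∑-mono-≤ (f≤g ∘ suc))

∑-linear₃ : ∀ {n} p q r (f g h : Fin n → ℕ) →
            ∑[ i < n ] (p * f i + q * g i + r * h i) ≡
            p * ∑[ i < n ] f i + q * ∑[ i < n ] g i + r * ∑[ i < n ] h i
∑-linear₃ {n} p q r f g h = begin
  ∑[ i < n ] (p * f i + q * g i + r * h i)
    ≡⟨ ∑-distrib-+ (λ i → p * f i + q * g i) (λ i → r * h i) ⟩
  ∑[ i < n ] (p * f i + q * g i) + ∑[ i < n ] (r * h i)
    ≡⟨ cong (_+ ∑[ i < n ] (r * h i)) (∑-distrib-+ (λ i → p * f i) (λ i → q * g i)) ⟩
  ∑[ i < n ] (p * f i) + ∑[ i < n ] (q * g i) + ∑[ i < n ] (r * h i)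
    ≡⟨ cong₂ _+_ (cong₂ _+_ (*-distribˡ-sum p f) (*-distribˡ-sum q g)) (*-distribˡ-sum r h) ⟨
  p * ∑[ i < n ] f i + q * ∑[ i < n ] g i + r * ∑[ i < n ] h i
    ∎
  where open ≡-Reasoning

∑-except-const : ∀ {n c} (f : Fin n → ℕ) i → (∀ j → j ≢ i → f j ≡ c) →
                 ∑[ j < n ] f j + c ≡ f i + n * c
∑-except-const {suc n} {c} f i f≡c = begin
  ∑[ j < suc n ] f j + c                ≡⟨ cong (_+ c) (sum-remove {i = i} f) ⟩
  f i + ∑[ j < n ] f (punchIn i j) + c  ≡⟨ cong (λ s → f i + s + c) others ⟩
  f i + n * c + c                       ≡⟨ +-assoc (f i) (n * c) c ⟩
  f i + (n * c + c)                     ≡⟨ cong (f i +_) (+-comm (n * c) c) ⟩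
  f i + suc n * c                       ∎
  where
  open ≡-Reasoning
  others : ∑[ j < n ] f (punchIn i j) ≡ n * c
  others = trans (sum-cong-≗ (λ j → f≡c _ (punchInᵢ≢i i j))) (∑-const n c)

term≤∑ : ∀ {n} (f : Fin n → ℕ) i → f i ≤ ∑[ j < n ] f j
term≤∑ {suc n} f i = ≤-trans (m≤m+n (f i) _) (≤-reflexive (sym (sum-remove {i = i} f)))

pair≤∑ : ∀ {n} (f : Fin n → ℕ) {i j} → i ≢ j → f i + f j ≤ ∑[ k < n ] f k
pair≤∑ {suc n} f {i} {j} i≢j = begin
  f i + f j                           ≡⟨ cong (λ k → f i + f k) (punchIn-punchOut i≢j) ⟨
  f i + f (punchIn i (punchOut i≢j))  ≤⟨ +-monoʳ-≤ (f i) (term≤∑ (f ∘ punchIn i) (punchOut i≢j)) ⟩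
  f i + ∑[ k < n ] f (punchIn i k)    ≡⟨ sum-remove {i = i} f ⟨
  ∑[ k < suc n ] f k                  ∎
  where open ≤-Reasoning

∑-tight : ∀ {n m} (f : Fin n → ℕ) → (∀ j → m ≤ f j) → ∑[ j < n ] f j ≤ n * m → ∀ i → f i ≤ m
∑-tight {suc n} {m} f m≤f ∑f≤ i = +-cancelʳ-≤ (n * m) (f i) m (begin
  f i + n * m                       ≡⟨ cong (f i +_) (∑-const n m) ⟨
  f i + ∑[ j < n ] m                ≤⟨ +-monoʳ-≤ (f i) (∑-mono-≤ (m≤f ∘ punchIn i)) ⟩
  f i + ∑[ j < n ] f (punchIn i j)  ≡⟨ sum-remove {i = i} f ⟨
  ∑[ j < suc n ] f j                ≤⟨ ∑f≤ ⟩
  m + n * m                         ∎)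
  where open ≤-Reasoning

-- Summing over positions (so repeated blocks count with multiplicity) makes the
-- Fin-indexed sum library, notably ∑-comm, available for sums over a list.
∑∈-syntax : ∀ {a} {A : Set a} → List A → (A → ℕ) → ℕ
∑∈-syntax xs f = ∑[ k < length xs ] f (lookup xs k)

infixl 10 ∑∈-syntax
syntax ∑∈-syntax xs (λ x → e) = ∑[ x ∈ xs ] e

module _ {a} {A : Set a} where

  length≡∑1 : ∀ (xs : List A) → length xs ≡ ∑[ x ∈ xs ] 1
  length≡∑1 xs = sym (trans (∑-const (length xs) 1) (*-identityʳ _))

  ∑∈-filter : ∀ {p} {P : A → Set p} (P? : ∀ x → Dec (P x)) xs (f : A → ℕ) →
              ∑[ x ∈ filter P? xs ] f x ≡ ∑[ x ∈ xs ] (χ (P? x) * f x)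
  ∑∈-filter P? []       f = refl
  ∑∈-filter P? (x ∷ xs) f with P? x
  ... | yes _ = cong₂ _+_ (sym (*-identityˡ (f x))) (∑∈-filter P? xs f)
  ... | no _  = ∑∈-filter P? xs f

  length-filter : ∀ {p} {P : A → Set p} (P? : ∀ x → Dec (P x)) xs →
                  length (filter P? xs) ≡ ∑[ x ∈ xs ] χ (P? x)
  length-filter P? xs = begin
    length (filter P? xs)       ≡⟨ length≡∑1 (filter P? xs) ⟩
    ∑[ x ∈ filter P? xs ] 1     ≡⟨ ∑∈-filter P? xs (λ _ → 1) ⟩
    ∑[ x ∈ xs ] (χ (P? x) * 1)  ≡⟨ sum-cong-≗ {length xs} (λ _ → *-identityʳ _) ⟩
    ∑[ x ∈ xs ] χ (P? x)        ∎
    where open ≡-Reasoning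

mod20≡10⇒mod4≡2 : ∀ {v} → v % 20 ≡ 10 → v % 4 ≡ 2
mod20≡10⇒mod4≡2 {v} v%20≡10 = begin
  v % 4                      ≡⟨ cong (_% 4) (trans (m≡m%n+[m/n]*n v 20) v%20+[v/20]*20) ⟩
  (10 + v / 20 * 5 * 4) % 4  ≡⟨ [m+kn]%n≡m%n 10 (v / 20 * 5) 4 ⟩
  2                          ∎
  where
  open ≡-Reasoning
  v%20+[v/20]*20 : v % 20 + v / 20 * 20 ≡ 10 + v / 20 * 5 * 4
  v%20+[v/20]*20 = cong₂ _+_ v%20≡10 (sym (*-assoc (v / 20) 5 4))

mod20≡10⇒20∣v²+5v+10 : ∀ {v} → v % 20 ≡ 10 → 20 ∣ v * v + 5 * v + 10
mod20≡10⇒20∣v²+5v+10 {v} v%20≡10 = divides (8 + k * 25 + k * k * 20) (begin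
  v * v + 5 * v + 10                                      ≡⟨ cong (λ w → w * w + 5 * w + 10) v≡10+k*20 ⟩
  (10 + k * 20) * (10 + k * 20) + 5 * (10 + k * 20) + 10  ≡⟨ expand k ⟩
  (8 + k * 25 + k * k * 20) * 20                          ∎)
  where
  open ≡-Reasoning
  k : ℕ
  k = v / 20
  v≡10+k*20 : v ≡ 10 + k * 20
  v≡10+k*20 = trans (m≡m%n+[m/n]*n v 20) (cong (_+ k * 20) v%20≡10)
  expand : ∀ k → (10 + k * 20) * (10 + k * 20) + 5 * (10 + k * 20) + 10 ≡ (8 + k * 25 + k * k * 20) * 20
  expand = solve-∀

three≤a+2t : ∀ {v} t a b → v % 4 ≡ 2 → 2 * t + 3 * a + 4 * b + 1 ≡ v → 3 ≤ a + 2 * t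
three≤a+2t t a b v%4≡2 refl = excluded t a (trans (sym drop-4b) v%4≡2)
  where
  rearrange : ∀ t a b → 2 * t + 3 * a + 4 * b + 1 ≡ 2 * t + 3 * a + 1 + b * 4
  rearrange = solve-∀
  drop-4b : (2 * t + 3 * a + 4 * b + 1) % 4 ≡ (2 * t + 3 * a + 1) % 4
  drop-4b = trans (cong (_% 4) (rearrange t a b)) ([m+kn]%n≡m%n (2 * t + 3 * a + 1) b 4)
  excluded : ∀ t a → (2 * t + 3 * a + 1) % 4 ≡ 2 → 3 ≤ a + 2 * t
  excluded 0 0 ()
  excluded 0 1 ()
  excluded 0 2 ()
  excluded 0 (suc (suc (suc a))) _ = s≤s (s≤s (s≤s z≤n))
  excluded 1 0 ()
  excluded 1 (suc a)             _ = s≤s (m≤n+m 2 a)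
  excluded (suc (suc t)) a       _ = ≤-trans (n≤1+n 3) (≤-trans (*-monoʳ-≤ 2 (m≤m+n 2 t)) (m≤n+m _ a))

triangle-balance : ∀ v T A B → 2 * (T * 3) + 3 * (A * 4) + 4 * (B * 5) + v ≡ v * v →
                   (T + A + B) * 20 ≡ v * v + 5 * v + 10 → A * 4 + 2 * (T * 3) + T ≡ 3 * v + 5
triangle-balance v T A B degrees blocks = *-cancelˡ-≡ _ _ 2 (+-cancelˡ-≡ (T * 6 + A * 12 + B * 20) _ _ (begin
  T * 6 + A * 12 + B * 20 + 2 * (A * 4 + 2 * (T * 3) + T)   ≡⟨ lhs T A B ⟩
  (T + A + B) * 20                                          ≡⟨ blocks ⟩
  v * v + 5 * v + 10                                        ≡⟨ cong (λ w → w + 5 * v + 10) degrees ⟨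
  2 * (T * 3) + 3 * (A * 4) + 4 * (B * 5) + v + 5 * v + 10  ≡⟨ rhs v T A B ⟩
  T * 6 + A * 12 + B * 20 + 2 * (3 * v + 5)                 ∎))
  where
  open ≡-Reasoning
  lhs : ∀ T A B → T * 6 + A * 12 + B * 20 + 2 * (A * 4 + 2 * (T * 3) + T) ≡ (T + A + B) * 20
  lhs = solve-∀
  rhs : ∀ v T A B → 2 * (T * 3) + 3 * (A * 4) + 4 * (B * 5) + v + 5 * v + 10 ≡
                    T * 6 + A * 12 + B * 20 + 2 * (3 * v + 5)
  rhs = solve-∀

module _ {v : ℕ} where
  open DecMembership (_≟ᶠ_ {v}) using (_∈?_)

  χ-∈-∷ : ∀ {c : Fin v} {C} y → c ∉ C → χ (y ∈? (c ∷ C)) ≡ χ (y ≟ᶠ c) + χ (y ∈? C)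
  χ-∈-∷ {c} {C} y c∉C with y ≟ᶠ c | y ∈? C
  ... | yes refl | yes y∈C = contradiction y∈C c∉C
  ... | yes _    | no _    = refl
  ... | no _     | yes _   = refl
  ... | no _     | no _    = refl

  ∑-χ≟ : ∀ (c : Fin v) → ∑[ y < v ] χ (y ≟ᶠ c) ≡ 1
  ∑-χ≟ c = begin
    ∑[ y < v ] χ (y ≟ᶠ c)      ≡⟨ +-identityʳ _ ⟨
    ∑[ y < v ] χ (y ≟ᶠ c) + 0  ≡⟨ ∑-except-const (λ y → χ (y ≟ᶠ c)) c (λ y → χ-no (y ≟ᶠ c)) ⟩
    χ (c ≟ᶠ c) + v * 0         ≡⟨ cong₂ _+_ (χ-yes (c ≟ᶠ c) refl) (*-zeroʳ v) ⟩
    1                          ∎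
    where open ≡-Reasoning

  ∑-χ∈ : ∀ {C : List (Fin v)} → Unique C → ∑[ y < v ] χ (y ∈? C) ≡ length C
  ∑-χ∈ {[]}    _              = trans (∑-const v 0) (*-zeroʳ v)
  ∑-χ∈ {c ∷ C} (c≢C ∷ unique) = begin
    ∑[ y < v ] χ (y ∈? (c ∷ C))                    ≡⟨ sum-cong-≗ (λ y → χ-∈-∷ y (All¬⇒¬Any c≢C)) ⟩
    ∑[ y < v ] (χ (y ≟ᶠ c) + χ (y ∈? C))           ≡⟨ ∑-distrib-+ (λ y → χ (y ≟ᶠ c)) (λ y → χ (y ∈? C)) ⟩
    ∑[ y < v ] χ (y ≟ᶠ c) + ∑[ y < v ] χ (y ∈? C)  ≡⟨ cong₂ _+_ (∑-χ≟ c) (∑-χ∈ unique) ⟩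
    suc (length C)                                 ∎
    where open ≡-Reasoning

  ∑-∑∈-χ∈ : ∀ {B : List (List (Fin v))} (g : List (Fin v) → ℕ) → (∀ {C} → C ∈ B → Unique C) →
            ∑[ y < v ] ∑[ C ∈ B ] (g C * χ (y ∈? C)) ≡ ∑[ C ∈ B ] (g C * length C)
  ∑-∑∈-χ∈ {B} g unique = begin
    ∑[ y < v ] ∑[ k < length B ] (g (B! k) * χ (y ∈? B! k))
      ≡⟨ ∑-comm (λ y k → g (B! k) * χ (y ∈? B! k)) ⟩
    ∑[ k < length B ] ∑[ y < v ] (g (B! k) * χ (y ∈? B! k))
      ≡⟨ sum-cong-≗ {length B} (λ k → *-distribˡ-sum {v} (g (B! k)) _) ⟨
    ∑[ k < length B ] (g (B! k) * ∑[ y < v ] χ (y ∈? B! k))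
      ≡⟨ sum-cong-≗ {length B} (λ k → cong (g (B! k) *_) (∑-χ∈ (unique (∈-lookup k)))) ⟩
    ∑[ C ∈ B ] (g C * length C)
      ∎
    where
    open ≡-Reasoning
    B! : Fin (length B) → List (Fin v)
    B! = lookup B

  length-blocksContaining : ∀ x y D →
                            length (blocksContaining x y D) ≡ ∑[ C ∈ D ] (χ (x ∈? C) * χ (y ∈? C))
  length-blocksContaining x y D =
    trans (length-filter (λ C → (x ∈? C) ×-dec (y ∈? C)) D)
          (sum-cong-≗ {length D} (λ k → χ-×-dec (x ∈? lookup D k) _))

  -- Count the pairs (z, C) with y, z ∈ C, first by C and then by z.
  degree-identity : ∀ {D} → IsCliqueDecomposition v D → ∀ y →
                    ∑[ C ∈ D ] (χ (y ∈? C) * length C) + 1 ≡ v + ∑[ C ∈ D ] χ (y ∈? C)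
  degree-identity {D} (unique , once) y = begin
    ∑[ C ∈ D ] (χ (y ∈? C) * length C) + 1
      ≡⟨ cong (_+ 1) (∑-∑∈-χ∈ (λ C → χ (y ∈? C)) (unique _)) ⟨
    ∑[ z < v ] ∑[ C ∈ D ] (χ (y ∈? C) * χ (z ∈? C)) + 1
      ≡⟨ ∑-except-const _ y once-elsewhere ⟩
    ∑[ C ∈ D ] (χ (y ∈? C) * χ (y ∈? C)) + v * 1
      ≡⟨ cong₂ _+_ (sum-cong-≗ {length D} (λ k → χ-idem (y ∈? lookup D k))) (*-identityʳ v) ⟩
    ∑[ C ∈ D ] χ (y ∈? C) + v
      ≡⟨ +-comm _ v ⟩
    v + ∑[ C ∈ D ] χ (y ∈? C)
      ∎
    where
    open ≡-Reasoning
    once-elsewhere : ∀ z → z ≢ y → ∑[ C ∈ D ] (χ (y ∈? C) * χ (z ∈? C)) ≡ 1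
    once-elsewhere z z≢y = trans (sym (length-blocksContaining y z D)) (once y z (z≢y ∘ sym))

  #ofSize : List (List (Fin v)) → ℕ → ℕ
  #ofSize D k = ∑[ C ∈ D ] χ (length C ≟ k)

  #ofSizeThrough : List (List (Fin v)) → ℕ → Fin v → ℕ
  #ofSizeThrough D k y = ∑[ C ∈ D ] (χ (length C ≟ k) * χ (y ∈? C))

  #ofSize-triangles : ∀ D → #ofSize D 3 ≡ length (triangles D)
  #ofSize-triangles D = sym (length-filter (λ C → length C ≟ 3) D)

  ∑-#ofSizeThrough : ∀ {D} → (∀ {C} → C ∈ D → Unique C) → ∀ k →
                     ∑[ y < v ] #ofSizeThrough D k y ≡ #ofSize D k * k
  ∑-#ofSizeThrough {D} unique k = begin
    ∑[ y < v ] #ofSizeThrough D k y            ≡⟨ ∑-∑∈-χ∈ (λ C → χ (length C ≟ k)) unique ⟩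
    ∑[ C ∈ D ] (χ (length C ≟ k) * length C)   ≡⟨ sum-cong-≗ {length D} (λ i → χ≟-*ʳ (length (lookup D i)) k) ⟩
    ∑[ C ∈ D ] (χ (length C ≟ k) * k)          ≡⟨ *-distribʳ-sum {length D} k _ ⟨
    #ofSize D k * k                            ∎
    where open ≡-Reasoning

  two≤#ofSizeThrough : ∀ D {y i j} → i ≢ j → y ∈ lookup (triangles D) i → y ∈ lookup (triangles D) j →
                       2 ≤ #ofSizeThrough D 3 y
  two≤#ofSizeThrough D {y} {i} {j} i≢j y∈Tᵢ y∈Tⱼ = begin
    2                                ≡⟨ cong₂ _+_ (χ-yes (y ∈? Tᵢ) y∈Tᵢ) (χ-yes (y ∈? Tⱼ) y∈Tⱼ) ⟨
    χ (y ∈? Tᵢ) + χ (y ∈? Tⱼ)        ≤⟨ pair≤∑ (λ k → χ (y ∈? lookup (triangles D) k)) i≢j ⟩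
    ∑[ C ∈ triangles D ] χ (y ∈? C)  ≡⟨ ∑∈-filter (λ C → length C ≟ 3) D (λ C → χ (y ∈? C)) ⟩
    #ofSizeThrough D 3 y             ∎
    where
    open ≤-Reasoning
    Tᵢ Tⱼ : List (Fin v)
    Tᵢ = lookup (triangles D) i
    Tⱼ = lookup (triangles D) j

  module _ {D : List (List (Fin v))} (size345 : ∀ C → C ∈ D → Size345 C) where

    ∑-by-size : ∀ (f : List (Fin v) → ℕ) →
                ∑[ C ∈ D ] f C ≡ ∑[ C ∈ D ] (χ (length C ≟ 3) * f C) + ∑[ C ∈ D ] (χ (length C ≟ 4) * f C)
                                 + ∑[ C ∈ D ] (χ (length C ≟ 5) * f C)
    ∑-by-size f =
      trans (sum-cong-≗ {length D} (λ k → χ-size345-split (size345 _ (∈-lookup k)) (f (lookup D k))))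
            (trans (∑-distrib-+ {length D} _ _)
                   (cong (_+ ∑[ C ∈ D ] (χ (length C ≟ 5) * f C)) (∑-distrib-+ {length D} _ _)))

    length-by-size : length D ≡ #ofSize D 3 + #ofSize D 4 + #ofSize D 5
    length-by-size = begin
      length D
        ≡⟨ length≡∑1 D ⟩
      ∑[ C ∈ D ] 1
        ≡⟨ sum-cong-≗ {length D} (λ k → sym (χ-size345-sum (size345 _ (∈-lookup k)))) ⟩
      ∑[ C ∈ D ] (χ (length C ≟ 3) + χ (length C ≟ 4) + χ (length C ≟ 5))
        ≡⟨ trans (∑-distrib-+ {length D} _ _) (cong (_+ #ofSize D 5) (∑-distrib-+ {length D} _ _)) ⟩
      #ofSize D 3 + #ofSize D 4 + #ofSize D 5
        ∎
      where open ≡-Reasoning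

    degree-by-size : IsCliqueDecomposition v D → ∀ y →
                     2 * #ofSizeThrough D 3 y + 3 * #ofSizeThrough D 4 y + 4 * #ofSizeThrough D 5 y + 1 ≡ v
    degree-by-size decomposition y = +-cancelˡ-≡ (t y + a y + b y) _ _ (begin
      t y + a y + b y + (2 * t y + 3 * a y + 4 * b y + 1)  ≡⟨ rearrange (t y) (a y) (b y) ⟩
      t y * 3 + a y * 4 + b y * 5 + 1                      ≡⟨ cong (_+ 1) weighted ⟨
      ∑[ C ∈ D ] (χ (y ∈? C) * length C) + 1               ≡⟨ degree-identity decomposition y ⟩
      v + ∑[ C ∈ D ] χ (y ∈? C)                            ≡⟨ cong (v +_) (∑-by-size (λ C → χ (y ∈? C))) ⟩
      v + (t y + a y + b y)                                ≡⟨ +-comm v _ ⟩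
      t y + a y + b y + v                                  ∎)
      where
      open ≡-Reasoning
      t a b : Fin v → ℕ
      t = #ofSizeThrough D 3
      a = #ofSizeThrough D 4
      b = #ofSizeThrough D 5
      rearrange : ∀ t a b → t + a + b + (2 * t + 3 * a + 4 * b + 1) ≡ t * 3 + a * 4 + b * 5 + 1
      rearrange = solve-∀
      weighted-by : ∀ k → ∑[ C ∈ D ] (χ (length C ≟ k) * (χ (y ∈? C) * length C)) ≡ #ofSizeThrough D k y * k
      weighted-by k = trans (sum-cong-≗ {length D} (λ i → χ≟-weight (length (lookup D i)) k _))
                            (sym (*-distribʳ-sum {length D} k _))
      weighted : ∑[ C ∈ D ] (χ (y ∈? C) * length C) ≡ t y * 3 + a y * 4 + b y * 5
      weighted = trans (∑-by-size (λ C → χ (y ∈? C) * length C))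
                       (cong₂ _+_ (cong₂ _+_ (weighted-by 3) (weighted-by 4)) (weighted-by 5))

    ∑-degree-by-size : IsCliqueDecomposition v D →
                       2 * (#ofSize D 3 * 3) + 3 * (#ofSize D 4 * 4) + 4 * (#ofSize D 5 * 5) + v ≡ v * v
    ∑-degree-by-size decomposition@(unique , _) = begin
      2 * (#ofSize D 3 * 3) + 3 * (#ofSize D 4 * 4) + 4 * (#ofSize D 5 * 5) + v
        ≡⟨ cong₂ _+_ (cong₂ _+_ (cong₂ _+_ (counted 2 3) (counted 3 4)) (counted 4 5)) (*-identityʳ v) ⟨
      2 * ∑[ y < v ] t y + 3 * ∑[ y < v ] a y + 4 * ∑[ y < v ] b y + v * 1
        ≡⟨ cong₂ _+_ (∑-linear₃ 2 3 4 t a b) (∑-const v 1) ⟨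
      ∑[ y < v ] (2 * t y + 3 * a y + 4 * b y) + ∑[ y < v ] 1
        ≡⟨ ∑-distrib-+ (λ y → 2 * t y + 3 * a y + 4 * b y) (λ _ → 1) ⟨
      ∑[ y < v ] (2 * t y + 3 * a y + 4 * b y + 1)
        ≡⟨ sum-cong-≗ (degree-by-size decomposition) ⟩
      ∑[ y < v ] v
        ≡⟨ ∑-const v v ⟩
      v * v
        ∎
      where
      open ≡-Reasoning
      t a b : Fin v → ℕ
      t = #ofSizeThrough D 3
      a = #ofSizeThrough D 4
      b = #ofSizeThrough D 5
      counted : ∀ c k → c * ∑[ y < v ] #ofSizeThrough D k y ≡ c * (#ofSize D k * k)
      counted c k = cong (c *_) (∑-#ofSizeThrough (unique _) k)

proposition10 : (v : ℕ) → v % 20 ≡ 10 →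
    (D : List (List (Fin v))) →
    IsCliqueDecomposition v D →
    ((C : List (Fin v)) → C ∈ D → Size345 C) →
    length D ≡ (v * v + 5 * v + 10) / 20 →
    length (triangles D) ≡ 5 →
    (i j : Fin (length (triangles D))) → i ≢ j →
    (x : Fin v) → ¬ (x ∈ lookup (triangles D) i × x ∈ lookup (triangles D) j)
proposition10 v v%20≡10 D decomposition@(unique , _) size345 |D| |T| i j i≢j x (x∈Tᵢ , x∈Tⱼ) =
  <-irrefl refl (≤-trans crowded tight)
  where
  open ≡-Reasoning
  t a : Fin v → ℕ
  t = #ofSizeThrough D 3
  a = #ofSizeThrough D 4
  S : ℕ → ℕ
  S = #ofSize D
  blocks : (S 3 + S 4 + S 5) * 20 ≡ v * v + 5 * v + 10
  blocks = trans (cong (_* 20) (trans (sym (length-by-size size345)) |D|))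
                 (m/n*n≡m (mod20≡10⇒20∣v²+5v+10 {v} v%20≡10))
  balance : ∑[ y < v ] (a y + 2 * t y) + 5 ≡ 3 * v + 5
  balance = begin
    ∑[ y < v ] (a y + 2 * t y) + 5
      ≡⟨ cong₂ _+_ (∑-distrib-+ a (λ y → 2 * t y)) (sym (trans (#ofSize-triangles D) |T|)) ⟩
    ∑[ y < v ] a y + ∑[ y < v ] (2 * t y) + S 3
      ≡⟨ cong (_+ S 3) (cong₂ _+_ (∑-#ofSizeThrough (unique _) 4) ∑2t) ⟩
    S 4 * 4 + 2 * (S 3 * 3) + S 3
      ≡⟨ triangle-balance v (S 3) (S 4) (S 5) (∑-degree-by-size size345 decomposition) blocks ⟩
    3 * v + 5
      ∎
    where
    ∑2t : ∑[ y < v ] (2 * t y) ≡ 2 * (S 3 * 3)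
    ∑2t = trans (sym (*-distribˡ-sum 2 t)) (cong (2 *_) (∑-#ofSizeThrough (unique _) 3))
  local : ∀ y → 3 ≤ a y + 2 * t y
  local y = three≤a+2t (t y) (a y) (#ofSizeThrough D 5 y)
                       (mod20≡10⇒mod4≡2 {v} v%20≡10) (degree-by-size size345 decomposition y)
  tight : a x + 2 * t x ≤ 3
  tight = ∑-tight (λ y → a y + 2 * t y) local
                  (≤-reflexive (trans (+-cancelʳ-≡ 5 _ _ balance) (*-comm 3 v))) x
  crowded : 4 ≤ a x + 2 * t x
  crowded = ≤-trans (*-monoʳ-≤ 2 (two≤#ofSizeThrough D i≢j x∈Tᵢ x∈Tⱼ)) (m≤n+m _ (a x))
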